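{- For all $I,B,P,Q:S\to\mathbb{B}$ and $C:S\to(E,S)\mathsf{itree}$: if $\{\lambda s.\,I(s)\wedge B(s)\}\,C\,\{I\}$, $P(s)\Rightarrow I(s)$ for all $s$, and $\neg B(s)\wedge I(s)\Rightarrow Q(s)$ for all $s$, then $\{P\}\,\mathsf{while}\ B\ \mathsf{invariant}\ I\ C\,\{Q\}$.
   Context: Fix a type $E$ of events; $(E,S)\mathsf{itree}$ is the codatatype with constructors $\mathsf{Ret}\,r$, $\mathsf{Sil}\,P$ ($\tau P$), $\mathsf{Vis}\,F$ ($F:E\rightharpoonup(E,S)\mathsf{itree}$ partial). Bind: $\mathsf{Ret}\,r\mathbin{>\!\!>\!\!=}K=K\,r$, $\tau P'\mathbin{>\!\!>\!\!=}K=\tau(P'\mathbin{>\!\!>\!\!=}K)$, $\mathsf{Vis}\,F\mathbin{>\!\!>\!\!=}K=\mathsf{Vis}(\lambda e\in\mathrm{dom}(F)\bullet F(e)\mathbin{>\!\!>\!\!=}K)$. $\mathsf{while}\ B\ C\ s=$ if $B(s)$ then $\tau(C(s)\mathbin{>\!\!>\!\!=}\mathsf{while}\ B\ C)$ else $\mathsf{Ret}\,s$ (corecursive). The annotated loop $\mathsf{while}\ B\ \mathsf{invariant}\ I\ C$ is by definition equal to $\mathsf{while}\ B\ C$ (the annotation has no semantic effect). Transition relation: least relation with $P\xrightarrow{[]}P$; $P\xrightarrow{tr}P'\Rightarrow\tau P\xrightarrow{tr}P'$; $e\in\mathrm{dom}(F)\wedge F(e)\xrightarrow{tr}P'\Rightarrow\mathsf{Vis}\,F\xrightarrow{e\#tr}P'$.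 Hoare triple: $\{P\}C\{Q\}\iff\forall s,s',tr.\,P(s)\wedge C(s)\xrightarrow{tr}\mathsf{Ret}\,s'\Rightarrow Q(s')$. -}

module Defs where

open import Data.Bool using (Bool; true; false; T; if_then_else_)
open import Data.List using (List; []; _∷_)
open import Data.Sum using (_⊎_; inj₁; inj₂)
open import Data.Product using (Σ; _,_)
open import Relation.Binary.PropositionalEquality using (_≡_)

-- One layer of an interaction tree with subtrees in X.  A partial function
-- F : E ⇀ X is represented by its (decidable) domain dom : E → Bool together
-- with F : (e : E) → T (dom e) → X.
data ITreeF (E S X : Set) : Set where
  Ret : S → ITreeF E S X
  Sil : X → ITreeF E S X
  Vis : (dom : E → Bool) → ((e : E) → T (dom e) → X) → ITreeF E S X

mapF : {E S X Y : Set} → (X → Y) → ITreeF E S X → ITreeF E S Y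
mapF f (Ret s) = Ret s
mapF f (Sil x) = Sil (f x)
mapF f (Vis dom F) = Vis dom (λ e d → f (F e d))

record ITree (E S : Set) : Set₁ where
  field
    Node : Set
    step : Node → ITreeF E S Node
    root : Node
open ITree public

-- Bind:  Ret r >>= K = K r ;  τ P >>= K = τ (P >>= K) ;
--        Vis F >>= K = Vis (λ e ∈ dom F • F e >>= K).
bind : {E S R : Set} → ITree E S → (S → ITree E R) → ITree E R
bind {E} {S} {R} P K = record { Node = N ; step = st ; root = inj₁ (root P) }
  where
  N : Set
  N = Node P ⊎ Σ S (λ r → Node (K r))
  st : N → ITreeF E R N
  st (inj₁ x) with step P x
  ... | Ret r = mapF (λ y → inj₂ (r , y)) (step (K r) (root (K r)))
  ... | Sil x' = Sil (inj₁ x')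
  ... | Vis dom F = Vis dom (λ e d → inj₁ (F e d))
  st (inj₂ (r , y)) = mapF (λ y' → inj₂ (r , y')) (step (K r) y)

-- while B C s = if B s then τ (C s >>= while B C) else Ret s   (corecursive).
-- Nodes: inj₁ s is the loop head  while B C s ; inj₂ (s₀ , x) is the
-- continuation  (x >>= while B C)  where x is a node of the body C s₀.
while : {E S : Set} → (S → Bool) → (S → ITree E S) → S → ITree E S
while {E} {S} B C s₀ = record { Node = N ; step = st ; root = inj₁ s₀ }
  where
  N : Set
  N = S ⊎ Σ S (λ s → Node (C s))
  head : S → ITreeF E S N
  head s = if B s then Sil (inj₂ (s , root (C s))) else Ret s
  st : N → ITreeF E S N
  st (inj₁ s) = head s
  st (inj₂ (s , x)) with step (C s) x
  ... | Ret r = head r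
  ... | Sil x' = Sil (inj₂ (s , x'))
  ... | Vis dom F = Vis dom (λ e d → inj₂ (s , F e d))

whileInv : {E S : Set} → (S → Bool) → (S → Bool) → (S → ITree E S) → S → ITree E S
whileInv B I C = while B C

data Trans {E S : Set} (t : ITree E S) : Node t → List E → Node t → Set where
  trefl : ∀ {x} → Trans t x [] x
  tsil  : ∀ {x x₁ tr x'} → step t x ≡ Sil x₁ → Trans t x₁ tr x' → Trans t x tr x'
  tvis  : ∀ {x dom F tr x'} → step t x ≡ Vis dom F →
          (e : E) (d : T (dom e)) → Trans t (F e d) tr x' → Trans t x (e ∷ tr) x'

Hoare : {E S : Set} → (S → Bool) → (S → ITree E S) → (S → Bool) → Set
Hoare {E} {S} P C Q =
  ∀ (s s' : S) (tr : List E) (x : Node (C s)) →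
  T (P s) → Trans (C s) (root (C s)) tr x → step (C s) x ≡ Ret s' → T (Q s')

-- The loop is proved correct by an invariant on the nodes of its unfolding:
-- at a loop head the state satisfies I, and inside an iteration started in
-- state s we have I s ∧ B s and the current node is reachable in the body
-- C s.  This invariant is preserved by every single step of the unfolding,
-- because a body step that returns lands on a loop head whose state satisfies
-- I by the Hoare triple for C; and when the loop exits, ¬ B ∧ I gives Q.

module Submission where

open import Defs
open import Data.Bool using (Bool; true; false; T; _∧_; not)
open import Data.Bool.Properties using (T-∧; T-≡; T-not-≡)
open import Data.List using (List; []; _∷_; _++_)
open import Data.Product using (∃; _×_; _,_)
open import Data.Sum using (inj₁; inj₂)
open import Function.Bundles using (Equivalence)
open import Relation.Binary.PropositionalEquality using (_≡_; subst)

open Equivalence using (from)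

Trans-snoc-Sil : ∀ {E S} {t : ITree E S} {a tr b b′} →
  Trans t a tr b → step t b ≡ Sil b′ → Trans t a tr b′
Trans-snoc-Sil trefl             eq = tsil eq trefl
Trans-snoc-Sil (tsil eq′ p)      eq = tsil eq′ (Trans-snoc-Sil p eq)
Trans-snoc-Sil (tvis eq′ e d p)  eq = tvis eq′ e d (Trans-snoc-Sil p eq)

Trans-snoc-Vis : ∀ {E S} {t : ITree E S} {a tr b dom F} →
  Trans t a tr b → step t b ≡ Vis dom F →
  (e : E) (d : T (dom e)) → Trans t a (tr ++ e ∷ []) (F e d)
Trans-snoc-Vis trefl              eq e d = tvis eq e d trefl
Trans-snoc-Vis (tsil eq′ p)       eq e d = tsil eq′ (Trans-snoc-Vis p eq e d)
Trans-snoc-Vis (tvis eq′ e′ d′ p) eq e d = tvis eq′ e′ d′ (Trans-snoc-Vis p eq e d)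

Reachable : ∀ {E S} (t : ITree E S) → Node t → Set
Reachable {E} t x = ∃ λ (tr : List E) → Trans t (root t) tr x

Successors : ∀ {E S X : Set} → (X → Set) → (S → Set) → ITreeF E S X → Set
Successors Inv Q (Ret s)     = Q s
Successors Inv Q (Sil x)     = Inv x
Successors Inv Q (Vis dom F) = ∀ e d → Inv (F e d)

StepInvariant : ∀ {E S} (t : ITree E S) → (Node t → Set) → (S → Set) → Set
StepInvariant t Inv Q = ∀ x → Inv x → Successors Inv Q (step t x)

module _ {E S : Set} {t : ITree E S} {Inv : Node t → Set} {Q : S → Set}
         (inv : StepInvariant t Inv Q) where

  Trans-preserves-invariant : ∀ {a tr b} → Inv a → Trans t a tr b → Inv b
  Trans-preserves-invariant i trefl              = i
  Trans-preserves-invariant i (tsil {x} eq p)    =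
    Trans-preserves-invariant (subst (Successors Inv Q) eq (inv x i)) p
  Trans-preserves-invariant i (tvis {x} eq e d p) =
    Trans-preserves-invariant (subst (Successors Inv Q) eq (inv x i) e d) p

  invariant⇒Ret : ∀ {a tr b s} → Inv a → Trans t a tr b → step t b ≡ Ret s → Q s
  invariant⇒Ret {b = b} i p eq =
    subst (Successors Inv Q) eq (inv b (Trans-preserves-invariant i p))

hoare-by-invariant : ∀ {E S} {P Q : S → Bool} {C : S → ITree E S}
  (Inv : (s : S) → Node (C s) → Set) →
  (∀ s → T (P s) → Inv s (root (C s))) →
  (∀ s → StepInvariant (C s) (Inv s) (λ s′ → T (Q s′))) →
  Hoare P C Q
hoare-by-invariant Inv init inv s s′ tr x ps p eq =
  invariant⇒Ret (inv s) (init s ps) p eq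

module WhileInvariant {E S : Set} (I B Q : S → Bool) (C : S → ITree E S)
    (body : Hoare (λ s → I s ∧ B s) C I)
    (exit : ∀ s → T (not (B s) ∧ I s) → T (Q s)) (s₀ : S) where

  W : ITree E S
  W = while B C s₀

  LoopInv : Node W → Set
  LoopInv (inj₁ s)       = T (I s)
  LoopInv (inj₂ (s , x)) = T (I s ∧ B s) × Reachable (C s) x

  head-invariant : ∀ s → T (I s) → Successors LoopInv (λ s′ → T (Q s′)) (step W (inj₁ s))
  head-invariant s i with B s in eqB
  ... | true  = from T-∧ (i , from T-≡ eqB) , [] , trefl
  ... | false = exit s (from T-∧ (from T-not-≡ eqB , i))

  while-invariant : StepInvariant W LoopInv (λ s′ → T (Q s′))
  while-invariant (inj₁ s) i = head-invariant s i
  while-invariant (inj₂ (s , x)) (ib , tr , p) with step (C s) x in eq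
  ... | Ret r     = head-invariant r (body s r tr x ib p eq)
  ... | Sil x′    = ib , tr , Trans-snoc-Sil p eq
  ... | Vis dom F = λ e d → ib , tr ++ e ∷ [] , Trans-snoc-Vis p eq e d

theorem4p23 : {E S : Set} (I B P Q : S → Bool) (C : S → ITree E S) →
    Hoare (λ s → I s ∧ B s) C I →
    (∀ s → T (P s) → T (I s)) →
    (∀ s → T (not (B s) ∧ I s) → T (Q s)) →
    Hoare P (whileInv B I C) Q
theorem4p23 I B P Q C body init exit =
  hoare-by-invariant (λ s → LoopInv s) init (λ s → while-invariant s)
  where open WhileInvariant I B Q C body exit
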